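{- Let $G=(V,E)$ be a finite graph (loops and multiple edges allowed), and let $\overleftrightarrow{E}$ be the set of arcs obtained by replacing each edge of $G$ by two arcs in opposite directions. Let $(y_a)_{a\in\overleftrightarrow{E}}$ and $(z_a)_{a\in\overleftrightarrow{E}}$ be indeterminates. Then $$\sum_{\alpha}\ \prod_{a\in \mathrm{Acy}(\alpha)}(1+y_a)\prod_{b\in \mathrm{Cyc}(\alpha)}(1+z_b)=\sum_{\phi}\ \prod_{a\in \mathrm{Acy}(\phi)}y_a\prod_{b\in \mathrm{Cyc}(\phi)}z_b,$$ where the left sum is over all orientations $\alpha$ of $G$ and the right sum is over all fourientations $\phi$ of $G$.
   Context: A fourientation $\phi$ of $G$ assigns to each edge one of four configurations: 0-way, 2-way, or one of two 1-way configurations (traversable in exactly one direction); loops also have these four configurations. The digraph $\vec\phi$ has two opposite arcs for each 2-way edge, the single allowed arc for each 1-way edge, and no arc for 0-way edges; thus fourientations correspond to subsets of $\overleftrightarrow{E}$. Orientations are fourientations in which every edge is 1-way. An arc $(x,y)$ of a digraph is cyclic if there is a directed path from $y$ to $x$, and acyclic otherwise. For a fourientation $\phi$, $\mathrm{Acy}(\phi)\subseteq\overleftrightarrow{E}$ (resp. $\mathrm{Cyc}(\phi)$) is the set of arcs corresponding to 1-way edges of $\phi$ which are acyclic (resp. cyclic) in $\vec\phi$; for an orientation this is the set of acyclic (resp. cyclic) arcs. -}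

module Defs where

open import Level using (Level)
open import Data.Nat using (ℕ; zero; suc)
open import Data.Fin using (Fin) renaming (zero to fzero; suc to fsuc)
open import Data.Bool using (Bool; true; false; not; if_then_else_; _∧_)
open import Data.Product using (_×_; _,_; proj₁; proj₂; ∃)
open import Data.Vec.Functional using (_∷_)
open import Relation.Binary.PropositionalEquality using (_≡_)
open import Relation.Binary.Construct.Closure.ReflexiveTransitive using (Star)
open import Relation.Nullary using (Dec; yes; no)
open import Algebra.Bundles using (CommutativeRing)

-- A finite multigraph with loops: vertices Fin n, edges Fin m,
-- `ends e = (u , v)` gives the two endpoints of edge e (u ≡ v for a loop).
Ends : ℕ → ℕ → Set
Ends n m = Fin m → Fin n × Fin n

-- Arcs: each edge e yields two arcs (e , false) : u → v and (e , true) : v → u.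
-- For a loop these are two distinct arcs u → u.
Arc : ℕ → Set
Arc m = Fin m × Bool

module _ {n m : ℕ} (ends : Ends n m) where

  tail : Arc m → Fin n
  tail (e , false) = proj₁ (ends e)
  tail (e , true)  = proj₂ (ends e)

  head : Arc m → Fin n
  head (e , false) = proj₂ (ends e)
  head (e , true)  = proj₁ (ends e)

rev : {m : ℕ} → Arc m → Arc m
rev (e , d) = (e , not d)

-- A fourientation is a subset of the arcs (characteristic function).
Fourientation : ℕ → Set
Fourientation m = Arc m → Bool

-- An orientation picks, for every edge, one of its two arcs.
Orientation : ℕ → Set
Orientation m = Fin m → Bool

orient→four : {m : ℕ} → Orientation m → Fourientation m
orient→four α (e , false) = not (α e)
orient→four α (e , true)  = α e

module _ {n m : ℕ} (ends : Ends n m) where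

  Step : Fourientation m → Fin n → Fin n → Set
  Step φ u v = ∃ λ (a : Arc m) → (φ a ≡ true) × (tail ends a ≡ u) × (head ends a ≡ v)

  Reach : Fourientation m → Fin n → Fin n → Set
  Reach φ = Star (Step φ)

  Cyclic : Fourientation m → Arc m → Set
  Cyclic φ a = Reach φ (head ends a) (tail ends a)

  oneWayArc : Fourientation m → Arc m → Bool
  oneWayArc φ a = φ a ∧ not (φ (rev a))

module Sums {c ℓ : Level} (R : CommutativeRing c ℓ) where
  open CommutativeRing R

  sumFun : (k : ℕ) → ((Fin k → Bool) → Carrier) → Carrier
  sumFun zero    f = f (λ ())
  sumFun (suc k) f = sumFun k (λ g → f (false ∷ g)) + sumFun k (λ g → f (true ∷ g))

  sumFour : (m : ℕ) → (Fourientation m → Carrier) → Carrier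
  sumFour m f = sumFun m (λ p → sumFun m (λ q → f (λ { (e , false) → p e ; (e , true) → q e })))

  prodFin : (k : ℕ) → (Fin k → Carrier) → Carrier
  prodFin zero    g = 1#
  prodFin (suc k) g = g fzero * prodFin k (λ i → g (fsuc i))

  prodArc : (m : ℕ) → (Arc m → Carrier) → Carrier
  prodArc m g = prodFin m (λ e → g (e , false) * g (e , true))

  module _ {n m : ℕ} (ends : Ends n m)
           (dec : (φ : Fourientation m) (u v : Fin n) → Dec (Reach ends φ u v)) where

    -- factor of arc a:  y a if a ∈ Acy(φ),  z a if a ∈ Cyc(φ),  1 otherwise
    factor : Fourientation m → (Arc m → Carrier) → (Arc m → Carrier) → Arc m → Carrier
    factor φ y z a with oneWayArc ends φ a | dec φ (head ends a) (tail ends a)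
    ... | false | _     = 1#
    ... | true  | yes _ = z a
    ... | true  | no  _ = y a

    weight : Fourientation m → (Arc m → Carrier) → (Arc m → Carrier) → Carrier
    weight φ y z = prodArc m (factor φ y z)

    lhs : (Arc m → Carrier) → (Arc m → Carrier) → Carrier
    lhs y z = sumFun m (λ α → weight (orient→four α) (λ a → 1# + y a) (λ a → 1# + z a))

    rhs : (Arc m → Carrier) → (Arc m → Carrier) → Carrier
    rhs y z = sumFour m (λ φ → weight φ y z)

module Submission where

-- Both sides are instances of one hybrid sum over pairs of edge labellings (p , q), in which each
-- edge is expanded either as on the left (an orientation together with a choice of the summand 1
-- or y/z of its factor) or as on the right (the set of its arcs that are present).  Switching a
-- single edge j from the right-hand to the left-hand expansion leaves the sum unchanged: the
-- one-way configurations of j match term by term, and the remaining terms, in which j carries no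
-- factor, satisfy W(0-way) + W(2-way) = W(→) + W(←), because whether any other arc is cyclic
-- depends on j only through reachability between the endpoints of j in the graph without j.

open import Defs
open import Level using (Level)
open import Function using (id; _∘_; _⇔_; mk⇔; Equivalence)
open import Data.Nat using (ℕ; zero; suc; _<_; _≤_; _<?_)
open import Data.Nat.Properties using (<⇒≤; n<1+n; ≤-refl; n≮0; n≮n; ≤∧≢⇒<; m<1+n⇒m≤n; m≤n⇒m≤1+n)
open import Data.Fin using (Fin; toℕ; fromℕ<) renaming (zero to fzero; suc to fsuc)
open import Data.Fin.Properties using (toℕ-fromℕ<; toℕ<n; toℕ-injective) renaming (_≟_ to _≟ᶠ_)
open import Data.Bool using (Bool; true; false; not; if_then_else_; _∧_)
open import Data.Bool.Properties using (∧-inverseʳ)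
open import Data.Product as Product using (_×_; _,_; proj₁; proj₂)
open import Data.Sum as Sum using (_⊎_; inj₁; inj₂)
open import Data.Empty using (⊥-elim)
open import Data.Vec.Functional using (Vector; _∷_)
open import Relation.Binary.PropositionalEquality
  using (_≡_; _≢_; refl; sym; trans; cong; cong₂; subst)
open import Relation.Binary.Construct.Closure.ReflexiveTransitive using (ε; _◅_; _◅◅_; kleisliStar)
open import Relation.Nullary using (Dec; yes; no; ¬_; does)
open import Relation.Nullary.Decidable using (dec-true; dec-false)
open import Algebra.Bundles using (CommutativeRing)

private
  variable
    a : Level
    A : Set a
    k : ℕ

infixl 6 _[_]≔_

_[_]≔_ : Vector A k → Fin k → A → Vector A k
g [ fzero  ]≔ b = b ∷ (g ∘ fsuc)
g [ fsuc j ]≔ b = g fzero ∷ ((g ∘ fsuc) [ j ]≔ b)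

[]≔-updates : (g : Vector A k) (j : Fin k) (b : A) → (g [ j ]≔ b) j ≡ b
[]≔-updates g fzero    b = refl
[]≔-updates g (fsuc j) b = []≔-updates (g ∘ fsuc) j b

[]≔-minimal : (g : Vector A k) {j e : Fin k} (b : A) → e ≢ j → (g [ j ]≔ b) e ≡ g e
[]≔-minimal g {fzero}  {fzero}  b e≢j = ⊥-elim (e≢j refl)
[]≔-minimal g {fzero}  {fsuc e} b _   = refl
[]≔-minimal g {fsuc j} {fzero}  b _   = refl
[]≔-minimal g {fsuc j} {fsuc e} b e≢j = []≔-minimal (g ∘ fsuc) b (e≢j ∘ cong fsuc)

pointwise-[]≔ : (f : Bool → Bool → Bool → A) {σ₀ σ : Fin k → Bool} {j : Fin k} {s : Bool}
  (p q : Fin k → Bool) (b c : Bool) → (∀ e → e ≢ j → σ e ≡ σ₀ e) → σ j ≡ s →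
  ∀ e → f (σ e) ((p [ j ]≔ b) e) ((q [ j ]≔ c) e) ≡ ((λ e → f (σ₀ e) (p e) (q e)) [ j ]≔ f s b c) e
pointwise-[]≔ f {j = j} p q b c off σj≡s e with e ≟ᶠ j
... | yes refl rewrite σj≡s | []≔-updates p j b | []≔-updates q j c = sym ([]≔-updates _ j _)
... | no e≢j   rewrite off e e≢j | []≔-minimal p b e≢j | []≔-minimal q c e≢j = sym ([]≔-minimal _ _ e≢j)

∧-true⇒ˡ : ∀ {p q} → p ∧ q ≡ true → p ≡ true
∧-true⇒ˡ {true} _ = refl

mkFour : {m : ℕ} → (Fin m → Bool) → (Fin m → Bool) → Fourientation m
mkFour P Q (e , false) = P e
mkFour P Q (e , true)  = Q e

module SumLemmas {c ℓ : Level} (R : CommutativeRing c ℓ) where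
  open CommutativeRing R renaming (refl to ≈-refl; sym to ≈-sym; trans to ≈-trans)
  open Sums R
  open import Algebra.Properties.CommutativeSemigroup +-commutativeSemigroup using (interchange)
  open import Relation.Binary.Reasoning.Setoid setoid

  1+-* : ∀ {w w⁺ w' w'⁺} → w⁺ ≡ 1# + w → w'⁺ ≡ 1# → w' ≡ 1# → w⁺ * w'⁺ ≈ 1# + w * w'
  1+-* refl refl refl = begin
    (1# + _) * 1# ≈⟨ *-identityʳ _ ⟩
    1# + _        ≈⟨ +-congˡ (≈-sym (*-identityʳ _)) ⟩
    1# + _ * 1#   ∎

  sumFun-cong : ∀ k {f g : (Fin k → Bool) → Carrier} → (∀ x → f x ≈ g x) → sumFun k f ≈ sumFun k g
  sumFun-cong zero    f≈g = f≈g _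
  sumFun-cong (suc k) f≈g = +-cong (sumFun-cong k (f≈g ∘ (false ∷_))) (sumFun-cong k (f≈g ∘ (true ∷_)))

  prodFin-cong : ∀ k {f g : Fin k → Carrier} → (∀ i → f i ≈ g i) → prodFin k f ≈ prodFin k g
  prodFin-cong zero    f≈g = ≈-refl
  prodFin-cong (suc k) f≈g = *-cong (f≈g fzero) (prodFin-cong k (f≈g ∘ fsuc))

  sumFun-+ : ∀ k (f g : (Fin k → Bool) → Carrier) →
    sumFun k (λ x → f x + g x) ≈ sumFun k f + sumFun k g
  sumFun-+ zero    f g = ≈-refl
  sumFun-+ (suc k) f g = ≈-trans (+-cong (sumFun-+ k _ _) (sumFun-+ k _ _)) (interchange _ _ _ _)

  sumFun-*ˡ : ∀ k r (f : (Fin k → Bool) → Carrier) → sumFun k (λ x → r * f x) ≈ r * sumFun k f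
  sumFun-*ˡ zero    r f = ≈-refl
  sumFun-*ˡ (suc k) r f = ≈-trans (+-cong (sumFun-*ˡ k r _) (sumFun-*ˡ k r _)) (≈-sym (distribˡ r _ _))

  sumFun-comm : ∀ k l (f : (Fin k → Bool) → (Fin l → Bool) → Carrier) →
    sumFun k (λ x → sumFun l (f x)) ≈ sumFun l (λ x' → sumFun k (λ x → f x x'))
  sumFun-comm zero    l f = ≈-refl
  sumFun-comm (suc k) l f = ≈-trans (+-cong (sumFun-comm k l _) (sumFun-comm k l _)) (≈-sym (sumFun-+ l _ _))

  prodFin-1+ : ∀ k (h : Fin k → Carrier) →
    prodFin k (λ i → 1# + h i) ≈ sumFun k (λ S → prodFin k (λ i → if S i then h i else 1#))
  prodFin-1+ zero    h = ≈-refl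
  prodFin-1+ (suc k) h = begin
    (1# + h fzero) * prodFin k (λ i → 1# + h (fsuc i)) ≈⟨ *-congˡ (prodFin-1+ k (h ∘ fsuc)) ⟩
    (1# + h fzero) * rest                              ≈⟨ distribʳ rest 1# (h fzero) ⟩
    1# * rest + h fzero * rest
      ≈⟨ +-cong (≈-sym (sumFun-*ˡ k 1# _)) (≈-sym (sumFun-*ˡ k (h fzero) _)) ⟩
    sumFun (suc k) (λ S → prodFin (suc k) (λ i → if S i then h i else 1#)) ∎
    where
    rest : Carrier
    rest = sumFun k (λ S → prodFin k (λ i → if S i then h (fsuc i) else 1#))

  sumFour-cong : ∀ k (f : Fourientation k → Carrier) (g : (Fin k → Bool) → (Fin k → Bool) → Carrier) →
    (∀ P Q φ → (∀ a → φ a ≡ mkFour P Q a) → f φ ≈ g P Q) →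
    sumFour k f ≈ sumFun k (λ P → sumFun k (g P))
  sumFour-cong k f g f≈g = sumFun-cong k λ P → sumFun-cong k λ Q →
    f≈g P Q _ λ { (e , false) → refl ; (e , true) → refl }

  sumFun-congAt : ∀ k (j : Fin k) (f g : (Fin k → Bool) → Carrier) →
    (∀ x → f (x [ j ]≔ false) + f (x [ j ]≔ true) ≈ g (x [ j ]≔ false) + g (x [ j ]≔ true)) →
    sumFun k f ≈ sumFun k g
  sumFun-congAt (suc k) fzero f g h = begin
    sumFun k (f ∘ (false ∷_)) + sumFun k (f ∘ (true ∷_))  ≈⟨ ≈-sym (sumFun-+ k _ _) ⟩
    sumFun k (λ x → f (false ∷ x) + f (true ∷ x))        ≈⟨ sumFun-cong k (h ∘ (false ∷_)) ⟩
    sumFun k (λ x → g (false ∷ x) + g (true ∷ x))        ≈⟨ sumFun-+ k _ _ ⟩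
    sumFun k (g ∘ (false ∷_)) + sumFun k (g ∘ (true ∷_))  ∎
  sumFun-congAt (suc k) (fsuc j) f g h =
    +-cong (sumFun-congAt k j (f ∘ (false ∷_)) (g ∘ (false ∷_)) (h ∘ (false ∷_)))
           (sumFun-congAt k j (f ∘ (true ∷_))  (g ∘ (true ∷_))  (h ∘ (true ∷_)))

  sumFun²-congAt : ∀ k (j : Fin k) (f g : (Fin k → Bool) → (Fin k → Bool) → Carrier) →
    (∀ x x' → let x₀ = x [ j ]≔ false; x₁ = x [ j ]≔ true; x₀' = x' [ j ]≔ false; x₁' = x' [ j ]≔ true in
       (f x₀ x₀' + f x₀ x₁') + (f x₁ x₀' + f x₁ x₁') ≈ (g x₀ x₀' + g x₀ x₁') + (g x₁ x₀' + g x₁ x₁')) →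
    sumFun k (λ x → sumFun k (f x)) ≈ sumFun k (λ x → sumFun k (g x))
  sumFun²-congAt k j f g h = sumFun-congAt k j _ _ λ x → begin
    sumFun k (f (x [ j ]≔ false)) + sumFun k (f (x [ j ]≔ true))
      ≈⟨ ≈-sym (sumFun-+ k _ _) ⟩
    sumFun k (λ x' → f (x [ j ]≔ false) x' + f (x [ j ]≔ true) x')
      ≈⟨ sumFun-congAt k j _ _ (λ x' → ≈-trans (interchange _ _ _ _) (≈-trans (h x x') (interchange _ _ _ _))) ⟩
    sumFun k (λ x' → g (x [ j ]≔ false) x' + g (x [ j ]≔ true) x')
      ≈⟨ sumFun-+ k _ _ ⟩
    sumFun k (g (x [ j ]≔ false)) + sumFun k (g (x [ j ]≔ true)) ∎

module Paths {n m : ℕ} (ends : Ends n m) where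

  Reach-simulate : {φ ψ : Fourientation m} →
    (∀ a → φ a ≡ true → ψ a ≡ true ⊎ Reach ends ψ (tail ends a) (head ends a)) →
    ∀ {x x'} → Reach ends φ x x' → Reach ends ψ x x'
  Reach-simulate {ψ = ψ} shortcut = kleisliStar id step
    where
    step : ∀ {x x'} → Step ends _ x x' → Reach ends ψ x x'
    step (a , present , refl , refl) with shortcut a present
    ... | inj₁ present′ = (a , present′ , refl , refl) ◅ ε
    ... | inj₂ path     = path

  Reach-≗ : {φ ψ : Fourientation m} → (∀ a → φ a ≡ ψ a) →
    ∀ {x x'} → Reach ends φ x x' → Reach ends ψ x x'
  Reach-≗ φ≗ψ = Reach-simulate (λ a present → inj₁ (trans (sym (φ≗ψ a)) present))

  module AtEdge (j : Fin m) (P Q : Fin m → Bool) where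

    u v : Fin n
    u = proj₁ (ends j)
    v = proj₂ (ends j)

    withEdge : Bool → Bool → Fourientation m
    withEdge b c = mkFour (P [ j ]≔ b) (Q [ j ]≔ c)

    withEdge-minimal : ∀ {e} → e ≢ j → ∀ b c b' c' d → withEdge b c (e , d) ≡ withEdge b' c' (e , d)
    withEdge-minimal e≢j b c b' c' false = trans ([]≔-minimal P b e≢j) (sym ([]≔-minimal P b' e≢j))
    withEdge-minimal e≢j b c b' c' true  = trans ([]≔-minimal Q c e≢j) (sym ([]≔-minimal Q c' e≢j))

    Reach-withEdge : ∀ {b c b' c'} →
      (b ≡ true → b' ≡ true ⊎ Reach ends (withEdge b' c') u v) →
      (c ≡ true → c' ≡ true ⊎ Reach ends (withEdge b' c') v u) →
      ∀ {x x'} → Reach ends (withEdge b c) x x' → Reach ends (withEdge b' c') x x'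
    Reach-withEdge {b} {c} {b'} {c'} forward backward = Reach-simulate shortcut
      where
      shortcut : ∀ a → withEdge b c a ≡ true →
        withEdge b' c' a ≡ true ⊎ Reach ends (withEdge b' c') (tail ends a) (head ends a)
      shortcut (e , d) present with e ≟ᶠ j
      shortcut (e , d) present | no e≢j = inj₁ (trans (sym (withEdge-minimal e≢j b c b' c' d)) present)
      shortcut (e , false) present | yes refl =
        Sum.map₁ (trans ([]≔-updates P j b')) (forward (trans (sym ([]≔-updates P j b)) present))
      shortcut (e , true) present | yes refl =
        Sum.map₁ (trans ([]≔-updates Q j c')) (backward (trans (sym ([]≔-updates Q j c)) present))

    deleted : Fourientation m
    deleted = withEdge false false

    Reach-deleted : ∀ {b c x x'} → Reach ends deleted x x' → Reach ends (withEdge b c) x x'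
    Reach-deleted = Reach-withEdge (λ ()) (λ ())

    ThroughEdge : Fin n → Fin n → Set
    ThroughEdge x x' = (Reach ends deleted x u ⊎ Reach ends deleted x v) × (Reach ends deleted u x' ⊎ Reach ends deleted v x')

    Reach-split : ∀ {b c x x'} → Reach ends (withEdge b c) x x' → Reach ends deleted x x' ⊎ ThroughEdge x x'
    Reach-split ε = inj₁ ε
    Reach-split {b} {c} (((e , d) , present , refl , refl) ◅ path) with e ≟ᶠ j | Reach-split path
    ... | no e≢j | rest = Sum.map (step ◅_) (Product.map₁ (Sum.map (step ◅_) (step ◅_))) rest
      where
      step : Step ends deleted (tail ends (e , d)) (head ends (e , d))
      step = (e , d) , trans (withEdge-minimal e≢j false false b c d) present , refl , refl
    Reach-split (((e , false) , _ , refl , refl) ◅ _) | yes refl | inj₁ path      = inj₂ (inj₁ ε , inj₂ path)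
    Reach-split (((e , false) , _ , refl , refl) ◅ _) | yes refl | inj₂ (_ , out) = inj₂ (inj₁ ε , out)
    Reach-split (((e , true)  , _ , refl , refl) ◅ _) | yes refl | inj₁ path      = inj₂ (inj₂ ε , inj₁ path)
    Reach-split (((e , true)  , _ , refl , refl) ◅ _) | yes refl | inj₂ (_ , out) = inj₂ (inj₂ ε , out)

    -- A cycle through a that uses edge j leaves and re-enters the graph without j at the same
    -- endpoint of j; otherwise, together with a, it would join u and v in that graph.
    Cyclic-deleted : ¬ Reach ends deleted u v → ¬ Reach ends deleted v u →
      ∀ {b c} a → deleted a ≡ true → Cyclic ends (withEdge b c) a → Cyclic ends deleted a
    Cyclic-deleted ¬u⇝v ¬v⇝u a present cycle with Reach-split cycle
    ... | inj₁ path = path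
    ... | inj₂ (inj₁ h⇝u , inj₁ u⇝t) = h⇝u ◅◅ u⇝t
    ... | inj₂ (inj₂ h⇝v , inj₂ v⇝t) = h⇝v ◅◅ v⇝t
    ... | inj₂ (inj₁ h⇝u , inj₂ v⇝t) = ⊥-elim (¬v⇝u (v⇝t ◅◅ (a , present , refl , refl) ◅ h⇝u))
    ... | inj₂ (inj₂ h⇝v , inj₁ u⇝t) = ⊥-elim (¬u⇝v (u⇝t ◅◅ (a , present , refl , refl) ◅ h⇝v))

module Weights {c ℓ : Level} (R : CommutativeRing c ℓ) {n m : ℕ} (ends : Ends n m)
  (dec : (φ : Fourientation m) (x x' : Fin n) → Dec (Reach ends φ x x'))
  (y z : Arc m → CommutativeRing.Carrier R) where

  open CommutativeRing R renaming (refl to ≈-refl; sym to ≈-sym; trans to ≈-trans)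
  open Sums R
  open SumLemmas R
  open Paths ends
  open import Relation.Binary.Reasoning.Setoid setoid

  factor-cong : ∀ {φ ψ a} → oneWayArc ends φ a ≡ oneWayArc ends ψ a →
    (oneWayArc ends φ a ≡ true → Cyclic ends φ a ⇔ Cyclic ends ψ a) →
    factor ends dec φ y z a ≡ factor ends dec ψ y z a
  factor-cong {φ} {ψ} {a} sameWay sameCycles
    with oneWayArc ends φ a | oneWayArc ends ψ a | dec φ (head ends a) (tail ends a) | dec ψ (head ends a) (tail ends a)
  ... | false | false | _      | _      = refl
  ... | true  | true  | yes _  | yes _  = refl
  ... | true  | true  | no _   | no _   = refl
  ... | true  | true  | yes φc | no ¬ψc = ⊥-elim (¬ψc (Equivalence.to (sameCycles refl) φc))
  ... | true  | true  | no ¬φc | yes ψc = ⊥-elim (¬φc (Equivalence.from (sameCycles refl) ψc))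
  ... | false | true  | _      | _      with () ← sameWay
  ... | true  | false | _      | _      with () ← sameWay

  factor-notOneWay : ∀ {φ a} y′ z′ → oneWayArc ends φ a ≡ false → factor ends dec φ y′ z′ a ≡ 1#
  factor-notOneWay {φ} {a} _ _ notOneWay with oneWayArc ends φ a | dec φ (head ends a) (tail ends a)
  ... | false | _ = refl
  ... | true  | _ with () ← notOneWay

  factor-1+ : ∀ {φ a} → oneWayArc ends φ a ≡ true →
    factor ends dec φ (λ b → 1# + y b) (λ b → 1# + z b) a ≡ 1# + factor ends dec φ y z a
  factor-1+ {φ} {a} oneWay with oneWayArc ends φ a | dec φ (head ends a) (tail ends a)
  ... | true  | yes _ = refl
  ... | true  | no _  = refl
  ... | false | _ with () ← oneWay

  edgeWeight : Fourientation m → Fin m → Carrier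
  edgeWeight φ e = factor ends dec φ y z (e , false) * factor ends dec φ y z (e , true)

  SameStatus : Fourientation m → Fourientation m → Fin m → Set
  SameStatus φ ψ e = ∀ d → φ (e , d) ≡ ψ (e , d) ×
                           (φ (e , d) ≡ true → Cyclic ends φ (e , d) ⇔ Cyclic ends ψ (e , d))

  SameStatus-reach : ∀ {φ ψ e} → (∀ d → φ (e , d) ≡ ψ (e , d)) →
    (∀ {x x'} → Reach ends φ x x' → Reach ends ψ x x') → (∀ {x x'} → Reach ends ψ x x' → Reach ends φ x x') →
    SameStatus φ ψ e
  SameStatus-reach same φ⊆ψ ψ⊆φ d = same d , λ _ → mk⇔ φ⊆ψ ψ⊆φ

  edgeWeight-cong : ∀ {φ ψ e} → SameStatus φ ψ e → edgeWeight φ e ≡ edgeWeight ψ e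
  edgeWeight-cong {φ} {ψ} {e} same = cong₂ _*_ (arc false) (arc true)
    where
    arc : ∀ d → factor ends dec φ y z (e , d) ≡ factor ends dec ψ y z (e , d)
    arc d = factor-cong (cong₂ (λ p q → p ∧ not q) (proj₁ (same d)) (proj₁ (same (not d))))
                        (proj₂ (same d) ∘ ∧-true⇒ˡ)

  edgeWeight-balanced : ∀ {φ e} → φ (e , false) ≡ φ (e , true) → edgeWeight φ e ≈ 1#
  edgeWeight-balanced {φ} {e} balanced = begin
    edgeWeight φ e ≈⟨ *-cong (reflexive (notOneWay false balanced)) (reflexive (notOneWay true (sym balanced))) ⟩
    1# * 1#        ≈⟨ *-identityˡ 1# ⟩
    1#             ∎
    where
    notOneWay : ∀ d → φ (e , d) ≡ φ (e , not d) → factor ends dec φ y z (e , d) ≡ 1#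
    notOneWay d same = factor-notOneWay {φ} {e , d} y z
      (subst (λ t → φ (e , d) ∧ not t ≡ false) same (∧-inverseʳ (φ (e , d))))

  edgeWeight⁺ : Fourientation m → Fin m → Carrier
  edgeWeight⁺ φ e = factor ends dec φ y⁺ z⁺ (e , false) * factor ends dec φ y⁺ z⁺ (e , true)
    where
    y⁺ z⁺ : Arc m → Carrier
    y⁺ a = 1# + y a
    z⁺ a = 1# + z a

  edgeWeight⁺-oneWay : ∀ {φ e} d → oneWayArc ends φ (e , d) ≡ true → oneWayArc ends φ (e , not d) ≡ false →
    edgeWeight⁺ φ e ≈ 1# + edgeWeight φ e
  edgeWeight⁺-oneWay {φ} {e} false oneWay other =
    1+-* (factor-1+ {φ} {e , false} oneWay)
         (factor-notOneWay {φ} {e , true} _ _ other) (factor-notOneWay {φ} {e , true} y z other)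
  edgeWeight⁺-oneWay {φ} {e} true oneWay other = begin
    edgeWeight⁺ φ e                                             ≈⟨ *-comm _ _ ⟩
    _ * _                                                       ≈⟨ 1+-* (factor-1+ {φ} {e , true} oneWay)
                                                                      (factor-notOneWay {φ} {e , false} _ _ other)
                                                                      (factor-notOneWay {φ} {e , false} y z other) ⟩
    1# + factor ends dec φ y z (e , true) * factor ends dec φ y z (e , false) ≈⟨ +-congˡ (*-comm _ _) ⟩
    1# + edgeWeight φ e                                         ∎

  oneWayArc-orientation : ∀ α e → oneWayArc ends (orient→four α) (e , α e) ≡ true ×
                                  oneWayArc ends (orient→four α) (e , not (α e)) ≡ false
  oneWayArc-orientation α e = chosen (α e) refl
    where
    chosen : ∀ b → α e ≡ b →
      oneWayArc ends (orient→four α) (e , b) ≡ true × oneWayArc ends (orient→four α) (e , not b) ≡ false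
    chosen false αe≡b = cong (λ t → not t ∧ not t) αe≡b , cong (λ t → t ∧ not (not t)) αe≡b
    chosen true  αe≡b = cong (λ t → t ∧ not (not t)) αe≡b , cong (λ t → not t ∧ not t) αe≡b

  edgeWeight⁺-orientation : ∀ α e → edgeWeight⁺ (orient→four α) e ≈ 1# + edgeWeight (orient→four α) e
  edgeWeight⁺-orientation α e =
    edgeWeight⁺-oneWay {orient→four α} {e} (α e) (proj₁ (oneWayArc-orientation α e)) (proj₂ (oneWayArc-orientation α e))

  markedWeight : Fourientation m → (Fin m → Bool) → Carrier
  markedWeight φ κ = prodFin m (λ e → if κ e then edgeWeight φ e else 1#)

  markedWeight-cong : ∀ {φ ψ κ κ'} → (∀ e → κ e ≡ κ' e) → (∀ e → κ e ≡ true → SameStatus φ ψ e) →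
    markedWeight φ κ ≈ markedWeight ψ κ'
  markedWeight-cong κ≗κ' same = prodFin-cong m λ e → reflexive (marked (κ≗κ' e) (edgeWeight-cong ∘ same e))
    where
    marked : ∀ {s s' w w'} → s ≡ s' → (s ≡ true → w ≡ w') → (if s then w else 1#) ≡ (if s' then w' else 1#)
    marked {true}  refl w≡w' = w≡w' refl
    marked {false} refl _    = refl

  markedWeight-≗ : ∀ {φ ψ κ κ'} → (∀ a → φ a ≡ ψ a) → (∀ e → κ e ≡ κ' e) →
    markedWeight φ κ ≈ markedWeight ψ κ'
  markedWeight-≗ φ≗ψ κ≗κ' = markedWeight-cong κ≗κ' λ e _ →
    SameStatus-reach (λ d → φ≗ψ (e , d)) (Reach-≗ φ≗ψ) (Reach-≗ (sym ∘ φ≗ψ))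

  markedWeight-unmark : ∀ {φ} κ j → edgeWeight φ j ≈ 1# →
    markedWeight φ (κ [ j ]≔ true) ≈ markedWeight φ (κ [ j ]≔ false)
  markedWeight-unmark {φ} κ j trivial = prodFin-cong m markedFactor
    where
    markedFactor : ∀ e → (if (κ [ j ]≔ true) e then edgeWeight φ e else 1#) ≈
                         (if (κ [ j ]≔ false) e then edgeWeight φ e else 1#)
    markedFactor e with e ≟ᶠ j
    ... | yes refl rewrite []≔-updates κ j true | []≔-updates κ j false = trivial
    ... | no e≢j   rewrite []≔-minimal κ true e≢j | []≔-minimal κ false e≢j = ≈-refl

  module Exchange (j : Fin m) (P Q : Fin m → Bool) where
    open AtEdge j P Q

    marked≢j : ∀ {κ : Fin m → Bool} {e} → κ j ≡ false → κ e ≡ true → e ≢ j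
    marked≢j κj≡false κe≡true refl with () ← trans (sym κj≡false) κe≡true

    markedWeight-withEdge : ∀ {κ : Fin m → Bool} b c b' c' → κ j ≡ false →
      (∀ {x x'} → Reach ends (withEdge b c) x x' → Reach ends (withEdge b' c') x x') →
      (∀ {x x'} → Reach ends (withEdge b' c') x x' → Reach ends (withEdge b c) x x') →
      markedWeight (withEdge b c) κ ≈ markedWeight (withEdge b' c') κ
    markedWeight-withEdge b c b' c' κj≡false ⊆ ⊇ = markedWeight-cong (λ _ → refl) λ e marked →
      SameStatus-reach (withEdge-minimal (marked≢j κj≡false marked) b c b' c') ⊆ ⊇

    -- If v ⇝ u (or u ⇝ v) without edge j, the arc v → u (or u → v) is redundant and the terms
    -- pair off; otherwise all four fourientations have the same cyclic arcs away from j.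
    unmarked-0way+2way≈1way+1way : ∀ κ → κ j ≡ false →
      markedWeight (withEdge false false) κ + markedWeight (withEdge true true) κ ≈
      markedWeight (withEdge true false) κ + markedWeight (withEdge false true) κ
    unmarked-0way+2way≈1way+1way κ κj≡false with dec deleted v u | dec deleted u v
    ... | yes v⇝u | _ = ≈-trans (+-cong W₀₀≈W₀₁ W₁₁≈W₁₀) (+-comm _ _)
      where
      W₀₀≈W₀₁ : markedWeight deleted κ ≈ markedWeight (withEdge false true) κ
      W₀₀≈W₀₁ = markedWeight-withEdge false false false true κj≡false
        Reach-deleted (Reach-withEdge (λ ()) (λ _ → inj₂ v⇝u))
      W₁₁≈W₁₀ : markedWeight (withEdge true true) κ ≈ markedWeight (withEdge true false) κ
      W₁₁≈W₁₀ = markedWeight-withEdge true true true false κj≡false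
        (Reach-withEdge (λ _ → inj₁ refl) (λ _ → inj₂ (Reach-deleted v⇝u)))
        (Reach-withEdge (λ _ → inj₁ refl) (λ ()))
    ... | no _ | yes u⇝v = +-cong W₀₀≈W₁₀ W₁₁≈W₀₁
      where
      W₀₀≈W₁₀ : markedWeight deleted κ ≈ markedWeight (withEdge true false) κ
      W₀₀≈W₁₀ = markedWeight-withEdge false false true false κj≡false
        Reach-deleted (Reach-withEdge (λ _ → inj₂ u⇝v) (λ ()))
      W₁₁≈W₀₁ : markedWeight (withEdge true true) κ ≈ markedWeight (withEdge false true) κ
      W₁₁≈W₀₁ = markedWeight-withEdge true true false true κj≡false
        (Reach-withEdge (λ _ → inj₂ (Reach-deleted u⇝v)) (λ _ → inj₁ refl))
        (Reach-withEdge (λ ()) (λ _ → inj₁ refl))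
    ... | no ¬v⇝u | no ¬u⇝v = +-cong (W₀₀≈ true false) (≈-trans (≈-sym (W₀₀≈ true true)) (W₀₀≈ false true))
      where
      W₀₀≈ : ∀ b c → markedWeight deleted κ ≈ markedWeight (withEdge b c) κ
      W₀₀≈ b c = markedWeight-cong (λ _ → refl) λ e marked d →
        withEdge-minimal (marked≢j κj≡false marked) false false b c d ,
        λ present → mk⇔ Reach-deleted (Cyclic-deleted ¬u⇝v ¬v⇝u (e , d) present)

module Hybrid {c ℓ : Level} (R : CommutativeRing c ℓ) {n m : ℕ} (ends : Ends n m)
  (dec : (φ : Fourientation m) (x x' : Fin n) → Dec (Reach ends φ x x'))
  (y z : Arc m → CommutativeRing.Carrier R) where

  open CommutativeRing R renaming (refl to ≈-refl; sym to ≈-sym; trans to ≈-trans)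
  open Sums R
  open SumLemmas R
  open Paths ends
  open Weights R ends dec y z
  open import Algebra.Properties.CommutativeSemigroup +-commutativeSemigroup using (interchange)
  open import Relation.Binary.Reasoning.Setoid setoid

  -- An edge e with σ e = true is summed as on the left: q e orients it and p e selects the term
  -- y or z (rather than 1) of its factor.  With σ e = false it is summed as on the right: p e and
  -- q e say which of its two arcs are present.
  fwdArc : Bool → Bool → Bool → Bool
  fwdArc σe pe qe = if σe then not qe else pe

  edgeMark : Bool → Bool → Bool
  edgeMark σe pe = if σe then pe else true

  hybridFwd : (σ p q : Fin m → Bool) → Fin m → Bool
  hybridFwd σ p q e = fwdArc (σ e) (p e) (q e)

  hybridMark : (σ p : Fin m → Bool) → Fin m → Bool
  hybridMark σ p e = edgeMark (σ e) (p e)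

  hybridWeight : (σ p q : Fin m → Bool) → Carrier
  hybridWeight σ p q = markedWeight (mkFour (hybridFwd σ p q) q) (hybridMark σ p)

  hybridSum : (Fin m → Bool) → Carrier
  hybridSum σ = sumFun m (λ p → sumFun m (hybridWeight σ p))

  hybridWeight-at : ∀ {σ₀ σ j s} p q b c → (∀ e → e ≢ j → σ e ≡ σ₀ e) → σ j ≡ s →
    hybridWeight σ (p [ j ]≔ b) (q [ j ]≔ c) ≈
    markedWeight (AtEdge.withEdge j (hybridFwd σ₀ p q) q (fwdArc s b c) c) (hybridMark σ₀ p [ j ]≔ edgeMark s b)
  hybridWeight-at {σ₀} {σ} {j} {s} p q b c off σj≡s =
    markedWeight-≗ arcs (pointwise-[]≔ (λ s b _ → edgeMark s b) p q b c off σj≡s)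
    where
    arcs : ∀ a → mkFour (hybridFwd σ (p [ j ]≔ b) (q [ j ]≔ c)) (q [ j ]≔ c) a ≡
                 AtEdge.withEdge j (hybridFwd σ₀ p q) q (fwdArc s b c) c a
    arcs (e , false) = pointwise-[]≔ fwdArc p q b c off σj≡s e
    arcs (e , true)  = refl

  hybridWeight-flipAt : ∀ {σ σ' j} → σ j ≡ false → σ' j ≡ true → (∀ e → e ≢ j → σ' e ≡ σ e) → ∀ p q →
    let p₀ = p [ j ]≔ false; p₁ = p [ j ]≔ true; q₀ = q [ j ]≔ false; q₁ = q [ j ]≔ true in
    (hybridWeight σ p₀ q₀ + hybridWeight σ p₀ q₁) + (hybridWeight σ p₁ q₀ + hybridWeight σ p₁ q₁) ≈
    (hybridWeight σ' p₀ q₀ + hybridWeight σ' p₀ q₁) + (hybridWeight σ' p₁ q₀ + hybridWeight σ' p₁ q₁)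
  hybridWeight-flipAt {σ} {σ'} {j} σj≡false σ'j≡true off p q = begin
    (hybridWeight σ (p [ j ]≔ false) (q [ j ]≔ false) + hybridWeight σ (p [ j ]≔ false) (q [ j ]≔ true)) +
    (hybridWeight σ (p [ j ]≔ true) (q [ j ]≔ false) + hybridWeight σ (p [ j ]≔ true) (q [ j ]≔ true))
      ≈⟨ +-cong (+-cong (old false false) (old false true)) (+-cong (old true false) (old true true)) ⟩
    (W false false true + W false true true) + (W true false true + W true true true)
      ≈⟨ regroup _ _ _ _ ⟩
    (W false false true + W true true true) + (W true false true + W false true true)
      ≈⟨ +-congʳ (+-cong (unmark false) (unmark true)) ⟩
    (W false false false + W true true false) + (W true false true + W false true true)
      ≈⟨ +-congʳ (unmarked-0way+2way≈1way+1way (κ [ j ]≔ false) ([]≔-updates κ j false)) ⟩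
    (W true false false + W false true false) + (W true false true + W false true true)
      ≈⟨ ≈-sym (+-cong (+-cong (new false false) (new false true)) (+-cong (new true false) (new true true))) ⟩
    (hybridWeight σ' (p [ j ]≔ false) (q [ j ]≔ false) + hybridWeight σ' (p [ j ]≔ false) (q [ j ]≔ true)) +
    (hybridWeight σ' (p [ j ]≔ true) (q [ j ]≔ false) + hybridWeight σ' (p [ j ]≔ true) (q [ j ]≔ true)) ∎
    where
    open AtEdge j (hybridFwd σ p q) q
    open Exchange j (hybridFwd σ p q) q
    κ : Fin m → Bool
    κ = hybridMark σ p
    W : Bool → Bool → Bool → Carrier
    W b c t = markedWeight (withEdge b c) (κ [ j ]≔ t)
    old : ∀ b c → hybridWeight σ (p [ j ]≔ b) (q [ j ]≔ c) ≈ W b c true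
    old b c = hybridWeight-at {σ} {σ} {j} p q b c (λ _ _ → refl) σj≡false
    new : ∀ b c → hybridWeight σ' (p [ j ]≔ b) (q [ j ]≔ c) ≈ W (not c) c b
    new b c = hybridWeight-at {σ} {σ'} {j} p q b c off σ'j≡true
    unmark : ∀ b → W b b true ≈ W b b false
    unmark b = markedWeight-unmark {withEdge b b} κ j
      (edgeWeight-balanced {withEdge b b} {j} (trans ([]≔-updates (hybridFwd σ p q) j b) (sym ([]≔-updates q j b))))
    regroup : ∀ w x w' x' → (w + x) + (w' + x') ≈ (w + x') + (w' + x)
    regroup w x w' x' = begin
      (w + x) + (w' + x')  ≈⟨ +-congˡ (+-comm w' x') ⟩
      (w + x) + (x' + w')  ≈⟨ interchange w x x' w' ⟩
      (w + x') + (x + w')  ≈⟨ +-congˡ (+-comm x w') ⟩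
      (w + x') + (w' + x)  ∎

  hybridSum-flipAt : ∀ {σ σ' j} → σ j ≡ false → σ' j ≡ true → (∀ e → e ≢ j → σ' e ≡ σ e) →
    hybridSum σ ≈ hybridSum σ'
  hybridSum-flipAt {j = j} σj≡false σ'j≡true off =
    sumFun²-congAt m j _ _ (hybridWeight-flipAt σj≡false σ'j≡true off)

  prefix : ℕ → Fin m → Bool
  prefix k e = does (toℕ e <? k)

  hybridSum-prefix : ∀ k → k ≤ m → hybridSum (prefix 0) ≈ hybridSum (prefix k)
  hybridSum-prefix zero    _   = ≈-refl
  hybridSum-prefix (suc k) k<m = ≈-trans (hybridSum-prefix k (<⇒≤ k<m)) (hybridSum-flipAt outside inside unchanged)
    where
    j : Fin m
    j = fromℕ< k<m
    j≡k : toℕ j ≡ k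
    j≡k = toℕ-fromℕ< k<m
    outside : prefix k j ≡ false
    outside = dec-false (toℕ j <? k) (λ j<k → n≮n k (subst (_< k) j≡k j<k))
    inside : prefix (suc k) j ≡ true
    inside = dec-true (toℕ j <? suc k) (subst (_< suc k) (sym j≡k) (n<1+n k))
    unchanged : ∀ e → e ≢ j → prefix (suc k) e ≡ prefix k e
    unchanged e e≢j with toℕ e <? k
    ... | yes e<k = trans (dec-true (toℕ e <? suc k) (m≤n⇒m≤1+n e<k)) (sym (dec-true (toℕ e <? k) e<k))
    ... | no  e≮k = trans (dec-false (toℕ e <? suc k) e≮1+k) (sym (dec-false (toℕ e <? k) e≮k))
      where
      e≮1+k : ¬ toℕ e < suc k
      e≮1+k e<1+k = e≮k (≤∧≢⇒< (m<1+n⇒m≤n e<1+k) (λ e≡k → e≢j (toℕ-injective (trans e≡k (sym j≡k)))))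

  lhs≈hybridSum : ∀ σ → (∀ e → σ e ≡ true) → lhs ends dec y z ≈ hybridSum σ
  lhs≈hybridSum σ allTrue = begin
    lhs ends dec y z
      ≈⟨ sumFun-cong m (λ α → prodFin-cong m (edgeWeight⁺-orientation α)) ⟩
    sumFun m (λ α → prodFin m (λ e → 1# + edgeWeight (orient→four α) e))
      ≈⟨ sumFun-cong m (λ α → prodFin-1+ m (edgeWeight (orient→four α))) ⟩
    sumFun m (λ α → sumFun m (markedWeight (orient→four α)))
      ≈⟨ sumFun-comm m m _ ⟩
    sumFun m (λ p → sumFun m (λ α → markedWeight (orient→four α) p))
      ≈⟨ sumFun-cong m (λ p → sumFun-cong m (λ α → markedWeight-≗ (arcs p α) (marks p))) ⟩
    hybridSum σ ∎
    where
    arcs : ∀ p α a → orient→four α a ≡ mkFour (hybridFwd σ p α) α a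
    arcs p α (e , false) = cong (λ s → fwdArc s (p e) (α e)) (sym (allTrue e))
    arcs p α (e , true)  = refl
    marks : ∀ p e → p e ≡ hybridMark σ p e
    marks p e = cong (λ s → edgeMark s (p e)) (sym (allTrue e))

  rhs≈hybridSum : ∀ σ → (∀ e → σ e ≡ false) → rhs ends dec y z ≈ hybridSum σ
  rhs≈hybridSum σ allFalse = sumFour-cong m (λ φ → weight ends dec φ y z) (hybridWeight σ) λ p q φ φ≗pq →
    markedWeight-≗ {φ} {κ = λ _ → true} (λ a → trans (φ≗pq a) (arcs p q a)) (marks p)
    where
    arcs : ∀ p q a → mkFour p q a ≡ mkFour (hybridFwd σ p q) q a
    arcs p q (e , false) = cong (λ s → fwdArc s (p e) (q e)) (sym (allFalse e))
    arcs p q (e , true)  = refl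
    marks : ∀ p e → true ≡ hybridMark σ p e
    marks p e = cong (λ s → edgeMark s (p e)) (sym (allFalse e))

corollary3p6 : {c ℓ : Level} (R : CommutativeRing c ℓ) (n m : ℕ) (ends : Ends n m)
    (dec : (φ : Fourientation m) (u v : Fin n) → Dec (Reach ends φ u v))
    (y z : Arc m → CommutativeRing.Carrier R) →
    CommutativeRing._≈_ R (Sums.lhs R ends dec y z) (Sums.rhs R ends dec y z)
corollary3p6 R n m ends dec y z = begin
  Sums.lhs R ends dec y z ≈⟨ lhs≈hybridSum (prefix m) (λ e → dec-true (toℕ e <? m) (toℕ<n e)) ⟩
  hybridSum (prefix m)    ≈⟨ ≈-sym (hybridSum-prefix m ≤-refl) ⟩
  hybridSum (prefix 0)    ≈⟨ ≈-sym (rhs≈hybridSum (prefix 0) (λ e → dec-false (toℕ e <? 0) n≮0)) ⟩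
  Sums.rhs R ends dec y z ∎
  where
  open CommutativeRing R using (setoid) renaming (sym to ≈-sym)
  open Hybrid R ends dec y z
  open import Relation.Binary.Reasoning.Setoid setoid
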